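{- If there exists a polynomial $Q$ such that every graph on $n$ vertices has a CS-separator of size at most $Q(n)$, then there exists a polynomial $P$ such that every graph $G$ satisfies $\chi(G)\le P(\mathbf{bp}_{or}(G))$.
   Context: $\chi(G)$ is the chromatic number. The oriented bipartite packing $\mathbf{bp}_{or}(G)$ of an undirected graph $G$ is the minimum $k$ such that there exist pairs $(A_1,B_1),\dots,(A_k,B_k)$ of disjoint vertex subsets with every vertex of $A_i$ adjacent to every vertex of $B_i$, such that every edge $xy$ satisfies $x\in A_i,y\in B_i$ or $y\in A_i,x\in B_i$ for some $i$, and there is no ordered pair $(x,y)$ and distinct $i\neq j$ with $x\in A_i\cap A_j$ and $y\in B_i\cap B_j$. A cut of $G=(V,E)$ is a pair $(A,B)$ with $A\cup B=V$, $A\cap B=\emptyset$; it separates a clique $K$ and a stable set $S$ if $K\subseteq A$, $S\subseteq B$. A CS-separator is a family of cuts separating every clique $K$ from every stable set $S$ with $K\cap S=\emptyset$. -}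

module Defs where

open import Data.Nat using (ℕ; zero; suc; _+_; _*_; _≤_)
open import Data.Bool using (Bool; true; false)
open import Data.Fin using (Fin)
open import Data.Fin.Subset using (Subset; _∈_; _∉_)
open import Data.List using (List; []; _∷_; length)
open import Data.List.Membership.Propositional using () renaming (_∈_ to _∈ₗ_)
open import Data.Product using (Σ; ∃; _×_; _,_)
open import Data.Sum using (_⊎_)
open import Relation.Nullary using (¬_)
open import Relation.Binary.PropositionalEquality using (_≡_; _≢_)

-- Polynomials with natural-number coefficients, given by their coefficient
-- list (constant term first), evaluated by Horner's rule.
Poly : Set
Poly = List ℕ

eval : Poly → ℕ → ℕ
eval []       x = 0
eval (c ∷ cs) x = c + x * eval cs x

record Graph (n : ℕ) : Set where
  field
    adj     : Fin n → Fin n → Bool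
    sym     : ∀ x y → adj x y ≡ adj y x
    irrefl  : ∀ x → adj x x ≡ false

open Graph public

Adj : ∀ {n} → Graph n → Fin n → Fin n → Set
Adj G x y = adj G x y ≡ true

IsClique : ∀ {n} → Graph n → Subset n → Set
IsClique G K = ∀ x y → x ∈ K → y ∈ K → x ≢ y → Adj G x y

IsStable : ∀ {n} → Graph n → Subset n → Set
IsStable G S = ∀ x y → x ∈ S → y ∈ S → ¬ Adj G x y

Disjoint : ∀ {n} → Subset n → Subset n → Set
Disjoint X Y = ∀ x → x ∈ X → x ∉ Y

-- A cut (A , V∖A) is represented by its side A; the other side is the complement.
Cut : ℕ → Set
Cut n = Subset n

Separates : ∀ {n} → Cut n → Subset n → Subset n → Set
Separates A K S = (∀ x → x ∈ K → x ∈ A) × (∀ x → x ∈ S → x ∉ A)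

IsCSSeparator : ∀ {n} → Graph n → List (Cut n) → Set
IsCSSeparator G F =
  ∀ K S → IsClique G K → IsStable G S → Disjoint K S →
  ∃ λ A → A ∈ₗ F × Separates A K S

-- Proper colouring with m colours; χ(G) ≤ m iff one exists.
Colourable : ∀ {n} → Graph n → ℕ → Set
Colourable {n} G m = Σ (Fin n → Fin m) λ c → ∀ x y → Adj G x y → c x ≢ c y

record OrientedBipartitePacking {n} (G : Graph n) (k : ℕ) : Set where
  field
    A B       : Fin k → Subset n
    disjoint  : ∀ i → Disjoint (A i) (B i)
    complete  : ∀ i x y → x ∈ A i → y ∈ B i → Adj G x y
    covers    : ∀ x y → Adj G x y →
                ∃ λ i → (x ∈ A i × y ∈ B i) ⊎ (y ∈ A i × x ∈ B i)
    unique    : ∀ x y i j → i ≢ j →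
                ¬ (x ∈ A i × x ∈ A j × y ∈ B i × y ∈ B j)

-- bp_or(G) ≤ k iff an oriented bipartite packing of size k exists
-- (padding with empty pairs shows the sizes are upward closed).

-- Given an oriented bipartite packing (A₁,B₁),…,(A_k,B_k) of G, let
-- H be the graph on {1,…,k} in which i ~ j when A_i and A_j meet. For a vertex x
-- of G, K_x = { i ∣ x ∈ A_i } is a clique of H, and S_x = { i ∣ x ∈ B_i } is a
-- stable set of H: an edge ij inside S_y, witnessed by x ∈ A_i ∩ A_j, would
-- cover the ordered pair (x,y) twice. K_x and S_x are disjoint since A_i ∩ B_i = ∅.
-- Colour x by the cut of a CS-separator of H separating K_x from S_x; this uses
-- at most Q(k) colours. If xy is an edge, covered by (A_i,B_i) say, then
-- i ∈ K_x ∩ S_y, and no cut puts K_x on one side and S_y on the other side,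
-- so x and y get different cuts.
module Submission where

open import Defs hiding (sym)
open import Data.Nat using (ℕ; _≤_)
open import Data.Bool using (Bool)
open import Data.Fin using (Fin; _≟_; inject≤)
open import Data.Fin.Properties using (inject≤-injective)
open import Data.Fin.Subset using (Subset; Nonempty; _∩_) renaming (_∈_ to _∈ˢ_)
open import Data.Fin.Subset.Properties using (nonempty?; ∩-comm; x∈p∩q⁺; x∈p∩q⁻)
open import Data.List using (List; length)
open import Data.List.Relation.Unary.Any using (index)
open import Data.List.Membership.Propositional using (_∈_)
open import Data.List.Membership.Setoid.Properties using (index-injective)
open import Data.Vec using (lookup; tabulate)
open import Data.Vec.Properties using ([]=⇒lookup; lookup⇒[]=; lookup∘tabulate)
open import Data.Product using (∃; _×_; _,_; proj₁; proj₂)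
open import Data.Sum using (_⊎_; inj₁; inj₂)
open import Function using (_∘_; _⇔_; mk⇔; Equivalence)
open import Relation.Nullary using (Dec; yes; no; ¬_; ¬?; _×-dec_)
open import Relation.Nullary.Decidable using (does; dec-true; dec-false; does-⇔)
open import Relation.Binary.PropositionalEquality
  using (_≡_; _≢_; refl; sym; trans; subst; ≢-sym; setoid)

module _ {k} (R : Fin k → Fin k → Set) (R? : ∀ i j → Dec (R i j))
         (R-sym : ∀ {i j} → R i j → R j i) (R-irrefl : ∀ {i} → ¬ R i i) where

  graphFromRelation : Graph k
  graphFromRelation = record
    { adj    = λ i j → does (R? i j)
    ; sym    = λ i j → does-⇔ (mk⇔ R-sym R-sym) (R? i j) (R? j i)
    ; irrefl = λ i → dec-false (R? i i) R-irrefl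
    }

  Adj-graphFromRelation : ∀ {i j} → Adj graphFromRelation i j ⇔ R i j
  Adj-graphFromRelation {i} {j} = mk⇔ Adj⇒R (dec-true (R? i j))
    where
    Adj⇒R : Adj graphFromRelation i j → R i j
    Adj⇒R with R? i j
    ... | yes r = λ _ → r
    ... | no _  = λ ()

Intersecting : ∀ {n k} → (Fin k → Subset n) → Fin k → Fin k → Set
Intersecting A i j = i ≢ j × Nonempty (A i ∩ A j)

module _ {n k} (A : Fin k → Subset n) where

  private
    Intersecting-sym : ∀ {i j} → Intersecting A i j → Intersecting A j i
    Intersecting-sym {i} {j} (i≢j , meet) =
      ≢-sym i≢j , subst Nonempty (∩-comm (A i) (A j)) meet

    Intersecting-irrefl : ∀ {i} → ¬ Intersecting A i i
    Intersecting-irrefl (i≢i , _) = i≢i refl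

    intersecting? : ∀ i j → Dec (Intersecting A i j)
    intersecting? i j = ¬? (i ≟ j) ×-dec nonempty? (A i ∩ A j)

  intersectionGraph : Graph k
  intersectionGraph =
    graphFromRelation (Intersecting A) intersecting? Intersecting-sym Intersecting-irrefl

  Adj-intersectionGraph : ∀ {i j} → Adj intersectionGraph i j ⇔ Intersecting A i j
  Adj-intersectionGraph =
    Adj-graphFromRelation _ intersecting? Intersecting-sym Intersecting-irrefl

containing : ∀ {n k} → (Fin k → Subset n) → Fin n → Subset k
containing A x = tabulate (λ i → lookup (A i) x)

module _ {n k} (A : Fin k → Subset n) {x : Fin n} {i : Fin k} where

  private
    f : Fin k → Bool
    f j = lookup (A j) x

  ∈-containing⁺ : x ∈ˢ A i → i ∈ˢ containing A x
  ∈-containing⁺ x∈ =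
    lookup⇒[]= i (containing A x) (trans (lookup∘tabulate f i) ([]=⇒lookup x∈))

  ∈-containing⁻ : i ∈ˢ containing A x → x ∈ˢ A i
  ∈-containing⁻ i∈ =
    lookup⇒[]= x (A i) (trans (sym (lookup∘tabulate f i)) ([]=⇒lookup i∈))

containing-isClique : ∀ {n k} (A : Fin k → Subset n) x →
                      IsClique (intersectionGraph A) (containing A x)
containing-isClique A x i j i∈ j∈ i≢j =
  Equivalence.from (Adj-intersectionGraph A)
    (i≢j , x , x∈p∩q⁺ (∈-containing⁻ A i∈ , ∈-containing⁻ A j∈))

module _ {n k} {G : Graph n} (O : OrientedBipartitePacking G k) where
  open OrientedBipartitePacking O

  private
    H : Graph k
    H = intersectionGraph A

  containing-B-isStable : ∀ y → IsStable H (containing B y)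
  containing-B-isStable y i j i∈ j∈ i~j
    with i≢j , x , x∈Aᵢ∩Aⱼ ← Equivalence.to (Adj-intersectionGraph A) i~j
    with x∈Aᵢ , x∈Aⱼ ← x∈p∩q⁻ (A i) (A j) x∈Aᵢ∩Aⱼ
    = unique x y i j i≢j
        (x∈Aᵢ , x∈Aⱼ , ∈-containing⁻ B i∈ , ∈-containing⁻ B j∈)

  containing-disjoint : ∀ x → Disjoint (containing A x) (containing B x)
  containing-disjoint x i i∈K i∈S =
    disjoint i x (∈-containing⁻ A i∈K) (∈-containing⁻ B i∈S)

  covers-containing : ∀ x y → Adj G x y →
    (∃ λ i → i ∈ˢ containing A x × i ∈ˢ containing B y) ⊎
    (∃ λ i → i ∈ˢ containing A y × i ∈ˢ containing B x)
  covers-containing x y x~y with covers x y x~y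
  ... | i , inj₁ (x∈A , y∈B) =
    inj₁ (i , ∈-containing⁺ A x∈A , ∈-containing⁺ B y∈B)
  ... | i , inj₂ (y∈A , x∈B) =
    inj₂ (i , ∈-containing⁺ A y∈A , ∈-containing⁺ B x∈B)

module SeparatorColouring {n k} (H : Graph k) (F : List (Cut k))
  (F-separates : IsCSSeparator H F) (K S : Fin n → Subset k)
  (K-clique : ∀ x → IsClique H (K x)) (S-stable : ∀ x → IsStable H (S x))
  (K-S-disjoint : ∀ x → Disjoint (K x) (S x)) where

  separatingCut : ∀ x → ∃ λ C → C ∈ F × Separates C (K x) (S x)
  separatingCut x =
    F-separates (K x) (S x) (K-clique x) (S-stable x) (K-S-disjoint x)

  cut : Fin n → Cut k
  cut x = proj₁ (separatingCut x)

  cut∈F : ∀ x → cut x ∈ F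
  cut∈F x = proj₁ (proj₂ (separatingCut x))

  cut-separates : ∀ x → Separates (cut x) (K x) (S x)
  cut-separates x = proj₂ (proj₂ (separatingCut x))

  colour : Fin n → Fin (length F)
  colour x = index (cut∈F x)

  colour-separates : ∀ {x y i} → i ∈ˢ K x → i ∈ˢ S y → colour x ≢ colour y
  colour-separates {x} {y} {i} i∈Kx i∈Sy same-colour =
    proj₂ (cut-separates y) i i∈Sy
      (subst (i ∈ˢ_) same-cut (proj₁ (cut-separates x) i i∈Kx))
    where
    same-cut : cut x ≡ cut y
    same-cut = index-injective (setoid (Cut k)) (cut∈F x) (cut∈F y) same-colour

  separator⇒colourable : (G : Graph n) →
    (∀ x y → Adj G x y →
       (∃ λ i → i ∈ˢ K x × i ∈ˢ S y) ⊎
       (∃ λ i → i ∈ˢ K y × i ∈ˢ S x)) →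
    Colourable G (length F)
  separator⇒colourable G edge-meets = colour , proper
    where
    proper : ∀ x y → Adj G x y → colour x ≢ colour y
    proper x y x~y with edge-meets x y x~y
    ... | inj₁ (i , i∈Kx , i∈Sy) = colour-separates i∈Kx i∈Sy
    ... | inj₂ (i , i∈Ky , i∈Sx) = colour-separates i∈Ky i∈Sx ∘ sym

colourable-mono : ∀ {n} {G : Graph n} {m m′} →
                  m ≤ m′ → Colourable G m → Colourable G m′
colourable-mono m≤m′ (c , proper) =
  (λ x → inject≤ (c x) m≤m′) ,
  (λ x y x~y → proper x y x~y ∘ inject≤-injective m≤m′ m≤m′ (c x) (c y))

lemma20 : (∃ λ (Q : Poly) → ∀ (n : ℕ) (G : Graph n) →
             ∃ λ F → IsCSSeparator G F × length F ≤ eval Q n)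
          → ∃ λ (P : Poly) → ∀ (n : ℕ) (G : Graph n) (k : ℕ) →
             OrientedBipartitePacking G k → Colourable G (eval P k)
lemma20 (Q , small-separator) = Q , colourable
  where
  colourable : ∀ n (G : Graph n) k →
               OrientedBipartitePacking G k → Colourable G (eval Q k)
  colourable n G k O =
    let open OrientedBipartitePacking O
        H = intersectionGraph A
        F , F-separates , |F|≤Q = small-separator k H
        open SeparatorColouring H F F-separates (containing A) (containing B)
               (containing-isClique A) (containing-B-isStable O) (containing-disjoint O)
    in colourable-mono {G = G} |F|≤Q (separator⇒colourable G (covers-containing O))
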